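{- If $G$ is a connected pseudo $2$-regular graph, then $G$ is the tree $T_2$, i.e. the tree on $7$ vertices consisting of a root of degree $3$ each of whose three neighbors has exactly one further neighbor, which is a leaf.
   Context: All graphs are finite, simple and without isolated vertices. For a vertex $i$, $d_i$ is its degree and $m_i=d_i^{ -1}\sum_{j:\, ji\in E(G)} d_j$ is its average $2$-degree. A graph is $k$-harmonic if $m_i=k$ for all vertices $i$; it is pseudo $k$-regular if it is $k$-harmonic but not $k$-regular (i.e. the degrees $d_i$ are not all equal). -}

module Defs where

open import Data.Nat using (ℕ; zero; suc; _+_; _*_; _≥_)
open import Data.Fin using (Fin; zero; suc)
open import Data.Bool using (Bool; true; false; if_then_else_)
open import Data.Product using (Σ; ∃; ∃-syntax; _×_)
open import Relation.Binary.PropositionalEquality using (_≡_; _≢_)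
open import Function.Bundles using (_↔_; Inverse)

record Graph (n : ℕ) : Set where
  field
    Adj    : Fin n → Fin n → Bool
    sym    : ∀ i j → Adj i j ≡ Adj j i
    irrefl : ∀ i → Adj i i ≡ false
open Graph public

sumFin : (n : ℕ) → (Fin n → ℕ) → ℕ
sumFin zero    f = 0
sumFin (suc n) f = f zero + sumFin n (λ j → f (suc j))

module _ {n : ℕ} (G : Graph n) where
  deg : Fin n → ℕ
  deg i = sumFin n (λ j → if Adj G i j then 1 else 0)

  -- 2-degree: Σ_{j ~ i} d_j   (so that m_i = twoDeg i / deg i)
  twoDeg : Fin n → ℕ
  twoDeg i = sumFin n (λ j → if Adj G i j then deg j else 0)

  NoIsolated : Set
  NoIsolated = ∀ i → deg i ≥ 1

  -- k-harmonic: m_i = k for all i, i.e. Σ_{j~i} d_j = k * d_i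
  -- (equivalent to m_i = k since d_i ≥ 1 for graphs without isolated vertices)
  Harmonic : ℕ → Set
  Harmonic k = ∀ i → twoDeg i ≡ k * deg i

  Regular : ℕ → Set
  Regular k = ∀ i → deg i ≡ k

  PseudoRegular : ℕ → Set
  PseudoRegular k = Harmonic k × ∃[ i ] ∃[ j ] deg i ≢ deg j

  data Walk : Fin n → Fin n → Set where
    [] : ∀ {i} → Walk i i
    step : ∀ {i j k} → Adj G i j ≡ true → Walk j k → Walk i k

  Connected : Set
  Connected = ∀ i j → Walk i j

-- The tree T₂ on Fin 7: root 0, its neighbours 1,2,3, and leaves 4,5,6
-- with edges 1-4, 2-5, 3-6.
T₂Adj : Fin 7 → Fin 7 → Bool
T₂Adj zero (suc zero) = true
T₂Adj zero (suc (suc zero)) = true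
T₂Adj zero (suc (suc (suc zero))) = true
T₂Adj (suc zero) zero = true
T₂Adj (suc (suc zero)) zero = true
T₂Adj (suc (suc (suc zero))) zero = true
T₂Adj (suc zero) (suc (suc (suc (suc zero)))) = true
T₂Adj (suc (suc (suc (suc zero)))) (suc zero) = true
T₂Adj (suc (suc zero)) (suc (suc (suc (suc (suc zero))))) = true
T₂Adj (suc (suc (suc (suc (suc zero))))) (suc (suc zero)) = true
T₂Adj (suc (suc (suc zero))) (suc (suc (suc (suc (suc (suc zero)))))) = true
T₂Adj (suc (suc (suc (suc (suc (suc zero)))))) (suc (suc (suc zero))) = true
T₂Adj _ _ = false

IsoT₂ : {n : ℕ} → Graph n → Set
IsoT₂ {n} G = Σ (Fin n ↔ Fin 7) λ f →
  ∀ i j → Adj G i j ≡ T₂Adj (Inverse.to f i) (Inverse.to f j)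

module Submission where

-- Let G be connected, without isolated vertices and 2-harmonic, i.e. the
-- degrees of the neighbours of every vertex x add up to 2·d(x).  Three local facts
-- follow from this identity alone:
--   * the neighbour of a leaf has degree 2;
--   * the two neighbours of a degree-2 vertex have degrees adding up to 4;
--   * the neighbours of a vertex of degree ≥ 3 all have degree 2 (each is ≥ 2 and
--     their average is 2), and looking past such a neighbour m shows d(x) = 3 and
--     that m carries a leaf ("an arm").
-- If no vertex had degree ≥ 3 there would be no leaves (a leaf sees a degree-3
-- vertex at distance 2), so G would be 2-regular; hence a pseudo 2-regular G has a
-- vertex r of degree 3 whose three arms span a copy of T₂.  The copy embeds T₂
-- injectively and maps neighbourhoods onto neighbourhoods, and such an embedding
-- into a connected graph is an isomorphism (its image is closed under adjacency).

open import Defs renaming (sym to Adj-sym)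
open import Data.Nat using (ℕ; zero; suc; _+_; _*_; _≤_; _≤?_; s≤s; z≤n)
open import Data.Nat.Properties
  using (≤-refl; ≤-antisym; <-irrefl; suc-injective; +-comm; +-identityʳ; *-comm;
         +-mono-≤; +-monoʳ-≤; +-cancelʳ-≤; +-cancelˡ-≡)
open import Data.Nat.ListAction using (sum)
open import Data.Bool using (Bool; true; false; if_then_else_)
open import Data.Bool.Properties using (⇔→≡) renaming (_≟_ to _≟ᵇ_)
open import Data.Fin using (Fin; zero; suc)
open import Data.Fin.Patterns using (0F; 1F; 2F; 3F; 4F; 5F; 6F)
open import Data.Fin.Properties using (all?; any?) renaming (_≟_ to _≟ᶠ_)
open import Data.List using (List; []; _∷_; map; length; filter; allFin; tabulate; lookup)
open import Data.List.Membership.Propositional using (_∈_)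
open import Data.List.Membership.Propositional.Properties
  using (∈-map⁺; ∈-map⁻; ∈-filter⁺; ∈-filter⁻; ∈-allFin; ∈-lookup)
import Data.List.Membership.DecPropositional as DecMembership
open import Data.List.Relation.Unary.Any using (here; there)
open import Data.List.Relation.Unary.All using (All; []; _∷_)
import Data.List.Relation.Unary.All as All
open import Data.List.Relation.Unary.AllPairs using ([]; _∷_)
open import Data.List.Relation.Unary.AllPairs.Properties using (++⁺)
import Data.List.Relation.Unary.All.Properties as All
open import Data.List.Relation.Unary.Unique.Propositional using (Unique)
open import Data.List.Relation.Unary.Unique.Propositional.Properties using (allFin⁺; filter⁺)
open import Data.Product using (Σ; Σ-syntax; _×_; _,_; proj₁; proj₂)
open import Data.Sum using (_⊎_; inj₁; inj₂)
open import Data.Empty using (⊥-elim)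
open import Function.Base using (_∘_)
open import Function.Definitions using (Injective)
open import Relation.Unary using (Decidable)
open import Relation.Nullary.Decidable using (yes; no; from-yes; _×-dec_; _→-dec_)
open import Function.Bundles using (_↔_; _⇔_; mk⇔; mk↔ₛ′; Inverse; Equivalence)
open import Relation.Binary.PropositionalEquality

tight-sum : ∀ {a b c e} → c ≤ a → e ≤ b → a + b ≡ c + e → a ≡ c × b ≡ e
tight-sum {a} {b} {c} {e} c≤a e≤b a+b≡c+e =
  a≡c , +-cancelˡ-≡ c b e (subst (λ z → z + b ≡ c + e) a≡c a+b≡c+e)
  where
  a≤c : a ≤ c
  a≤c = +-cancelʳ-≤ b a c (subst (_≤ c + b) (sym a+b≡c+e) (+-monoʳ-≤ c e≤b))
  a≡c : a ≡ c
  a≡c = ≤-antisym a≤c c≤a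

sum-lower : ∀ {A : Set} k (f : A → ℕ) xs → All (λ x → k ≤ f x) xs →
  length xs * k ≤ sum (map f xs)
sum-lower k f []       []           = z≤n
sum-lower k f (x ∷ xs) (k≤fx ∷ k≤f) = +-mono-≤ k≤fx (sum-lower k f xs k≤f)

sum-tight : ∀ {A : Set} k (f : A → ℕ) xs → All (λ x → k ≤ f x) xs →
  sum (map f xs) ≡ length xs * k → All (λ x → f x ≡ k) xs
sum-tight k f []       []           _   = []
sum-tight k f (x ∷ xs) (k≤fx ∷ k≤f) sum≡ = proj₁ split ∷ sum-tight k f xs k≤f (proj₂ split)
  where
  split : f x ≡ k × sum (map f xs) ≡ length xs * k
  split = tight-sum k≤fx (sum-lower k f xs k≤f) sum≡

sumFin-filter : ∀ {A : Set} n (v : Fin n → A) (p : A → Bool) (h : A → ℕ) →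
  sumFin n (λ j → if p (v j) then h (v j) else 0)
    ≡ sum (map h (filter (λ a → p a ≟ᵇ true) (tabulate v)))
sumFin-filter zero    v p h = refl
sumFin-filter (suc n) v p h with p (v zero)
... | true  = cong (h (v zero) +_) (sumFin-filter n (λ j → v (suc j)) p h)
... | false = sumFin-filter n (λ j → v (suc j)) p h

sum-ones : ∀ {A : Set} (xs : List A) → sum (map (λ _ → 1) xs) ≡ length xs
sum-ones []       = refl
sum-ones (x ∷ xs) = cong suc (sum-ones xs)

∈-swap : ∀ {A : Set} {y a b : A} → y ∈ a ∷ b ∷ [] → y ∈ b ∷ a ∷ []
∈-swap (here y≡a)         = there (here y≡a)
∈-swap (there (here y≡b)) = here y≡b

∈-map-injective : ∀ {A B : Set} {f : A → B} → Injective _≡_ _≡_ f →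
  ∀ {y L} → f y ∈ map f L → y ∈ L
∈-map-injective {f = f} f-inj fy∈ with ∈-map⁻ f fy∈
... | s , s∈L , fy≡fs = subst (_∈ _) (sym (f-inj fy≡fs)) s∈L

lookup-injective : ∀ {A : Set} {xs : List A} → Unique xs → Injective _≡_ _≡_ (lookup xs)
lookup-injective {xs = x ∷ xs} _           {zero}  {zero}  _ = refl
lookup-injective {xs = x ∷ xs} (x∉xs ∷ _)  {zero}  {suc j} e = ⊥-elim (All.lookup x∉xs (∈-lookup j) e)
lookup-injective {xs = x ∷ xs} (x∉xs ∷ _)  {suc i} {zero}  e = ⊥-elim (All.lookup x∉xs (∈-lookup i) (sym e))
lookup-injective {xs = x ∷ xs} (_    ∷ xs!) {suc i} {suc j} e = cong suc (lookup-injective xs! e)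

Nbhd : ∀ {n} → (Fin n → Fin n → Bool) → Fin n → List (Fin n) → Set
Nbhd A x L = ∀ y → A x y ≡ true ⇔ y ∈ L

module Neighbours {n : ℕ} (G : Graph n) where

  adj-sym : ∀ {x y} → Adj G x y ≡ true → Adj G y x ≡ true
  adj-sym {x} {y} e = trans (Adj-sym G y x) e

  along-walk : (P : Fin n → Set) → (∀ {x y} → Adj G x y ≡ true → P x → P y) →
    ∀ {x y} → Walk G x y → P x → P y
  along-walk P step-P []           px = px
  along-walk P step-P (step e walk) px = along-walk P step-P walk (step-P e px)

  adjacent? : ∀ x → Decidable (λ y → Adj G x y ≡ true)
  adjacent? x y = Adj G x y ≟ᵇ true

  N : Fin n → List (Fin n)
  N x = filter (adjacent? x) (allFin n)

  N-nbhd : ∀ x → Nbhd (Adj G) x (N x)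
  N-nbhd x y = mk⇔ (∈-filter⁺ (adjacent? x) (∈-allFin y))
                   (λ y∈N → proj₂ (∈-filter⁻ (adjacent? x) {xs = allFin n} y∈N))

  N-unique : ∀ x → Unique (N x)
  N-unique x = filter⁺ _ (allFin⁺ n)

  deg≡length : ∀ x → deg G x ≡ length (N x)
  deg≡length x = trans (sumFin-filter n (λ j → j) (Adj G x) (λ _ → 1)) (sum-ones (N x))

  twoDeg≡sum : ∀ x → twoDeg G x ≡ sum (map (deg G) (N x))
  twoDeg≡sum x = sumFin-filter n (λ j → j) (Adj G x) (deg G)

  leaves-distinct : ∀ {l l′ m m′} → Nbhd (Adj G) l (m ∷ []) → Nbhd (Adj G) l′ (m′ ∷ []) →
    m ≢ m′ → l ≢ l′
  leaves-distinct {m′ = m′} nb nb′ m≢m′ refl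
    with Equivalence.to (nb m′) (Equivalence.from (nb′ m′) (here refl))
  ... | here m′≡m = m≢m′ (sym m′≡m)

module Embedding {n m : ℕ} (G : Graph n) (conn : Connected G)
  (HAdj : Fin (suc m) → Fin (suc m) → Bool) (H-nbrs : Fin (suc m) → List (Fin (suc m)))
  (H-nbhd : ∀ p → Nbhd HAdj p (H-nbrs p))
  (f : Fin (suc m) → Fin n) (f-inj : Injective _≡_ _≡_ f)
  (f-nbhd : ∀ p → Nbhd (Adj G) (f p) (map f (H-nbrs p))) where

  open Neighbours G using (along-walk)
  open Equivalence using (to; from)

  Image : Fin n → Set
  Image y = Σ[ p ∈ Fin (suc m) ] f p ≡ y

  -- The image of f is closed under adjacency, so by connectivity it is everything.
  image-closed : ∀ {x y} → Adj G x y ≡ true → Image x → Image y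
  image-closed {y = y} e (p , refl) with ∈-map⁻ f (to (f-nbhd p y) e)
  ... | s , _ , y≡fs = s , sym y≡fs

  onto : ∀ y → Image y
  onto y = along-walk Image image-closed (conn (f zero) y) (zero , refl)

  f⁻¹ : Fin n → Fin (suc m)
  f⁻¹ y = proj₁ (onto y)

  f∘f⁻¹ : ∀ y → f (f⁻¹ y) ≡ y
  f∘f⁻¹ y = proj₂ (onto y)

  f⁻¹∘f : ∀ p → f⁻¹ (f p) ≡ p
  f⁻¹∘f p = f-inj (f∘f⁻¹ (f p))

  f-adj : ∀ p q → Adj G (f p) (f q) ≡ HAdj p q
  f-adj p q = ⇔→≡ (mk⇔
    (λ e → from (H-nbhd p q) (∈-map-injective f-inj (to (f-nbhd p (f q)) e)))
    (λ e → from (f-nbhd p (f q)) (∈-map⁺ f (to (H-nbhd p q) e))))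

  iso : Σ (Fin n ↔ Fin (suc m)) λ g →
          ∀ i j → Adj G i j ≡ HAdj (Inverse.to g i) (Inverse.to g j)
  iso = mk↔ₛ′ f⁻¹ f f⁻¹∘f f∘f⁻¹ ,
        λ i j → trans (cong₂ (Adj G) (sym (f∘f⁻¹ i)) (sym (f∘f⁻¹ j))) (f-adj (f⁻¹ i) (f⁻¹ j))

T₂-nbrs : Fin 7 → List (Fin 7)
T₂-nbrs 0F = 1F ∷ 2F ∷ 3F ∷ []
T₂-nbrs 1F = 0F ∷ 4F ∷ []
T₂-nbrs 2F = 0F ∷ 5F ∷ []
T₂-nbrs 3F = 0F ∷ 6F ∷ []
T₂-nbrs 4F = 1F ∷ []
T₂-nbrs 5F = 2F ∷ []
T₂-nbrs 6F = 3F ∷ []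

T₂-nbhd : ∀ p → Nbhd T₂Adj p (T₂-nbrs p)
T₂-nbhd p s = mk⇔ (proj₁ (table p s)) (proj₂ (table p s))
  where
  open DecMembership (_≟ᶠ_ {7}) using (_∈?_)
  table : ∀ p s → (T₂Adj p s ≡ true → s ∈ T₂-nbrs p) × (s ∈ T₂-nbrs p → T₂Adj p s ≡ true)
  table = from-yes (all? λ (p : Fin 7) → all? λ (s : Fin 7) →
    ((T₂Adj p s ≟ᵇ true) →-dec (s ∈? T₂-nbrs p)) ×-dec
    ((s ∈? T₂-nbrs p) →-dec (T₂Adj p s ≟ᵇ true)))

module TwoHarmonic {n : ℕ} (G : Graph n) (no-isolated : NoIsolated G) (harmonic : Harmonic G 2)
  where
  open Neighbours G
  open Equivalence using (to; from)

  d : Fin n → ℕ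
  d = deg G

  record Star (x : Fin n) (k : ℕ) : Set where
    constructor mkStar
    field
      nbrs    : List (Fin n)
      nbhd    : Nbhd (Adj G) x nbrs
      unique  : Unique nbrs
      size    : length nbrs ≡ k
      balance : sum (map d nbrs) ≡ 2 * k

  star : ∀ x → Star x (d x)
  star x = mkStar (N x) (N-nbhd x) (N-unique x) (sym (deg≡length x))
                  (trans (sym (twoDeg≡sum x)) (harmonic x))

  some-nbr : ∀ x → Σ[ y ∈ Fin n ] Adj G x y ≡ true
  some-nbr x = first (star x) (no-isolated x)
    where
    first : ∀ {k} → Star x k → 1 ≤ k → Σ[ y ∈ Fin n ] Adj G x y ≡ true
    first (mkStar (y ∷ _) nb _ _    _) _  = y , from (nb y) (here refl)
    first (mkStar []      _  _ refl _) ()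

  leaf-nbr : ∀ {x} → Star x 1 → Σ[ y ∈ Fin n ] Nbhd (Adj G) x (y ∷ []) × d y ≡ 2
  leaf-nbr (mkStar (y ∷ []) nb _ refl bal) = y , nb , trans (sym (+-identityʳ (d y))) bal

  other-nbr : ∀ {x u} → Star x 2 → Adj G x u ≡ true →
    Σ[ w ∈ Fin n ] Nbhd (Adj G) x (u ∷ w ∷ []) × d u + d w ≡ 4
  other-nbr (mkStar (p ∷ q ∷ []) nb _ refl bal) e with to (nb _) e
  ... | here refl = q , nb , trans (cong (d p +_) (sym (+-identityʳ (d q)))) bal
  ... | there (here refl) =
    p , (λ y → mk⇔ (∈-swap ∘ to (nb y)) (from (nb y) ∘ ∈-swap)) ,
    trans (+-comm (d q) (d p)) (trans (cong (d p +_) (sym (+-identityʳ (d q)))) bal)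

  leaf-nbr-deg : ∀ {x y} → d x ≡ 1 → Adj G x y ≡ true → d y ≡ 2
  leaf-nbr-deg {x} {y} dx e with leaf-nbr (subst (Star x) dx (star x))
  ... | z , nb , dz with to (nb y) e
  ... | here refl = dz

  only-nbr-of-leaf : ∀ {l m} → d l ≡ 1 → Adj G l m ≡ true → Nbhd (Adj G) l (m ∷ [])
  only-nbr-of-leaf {l} {m} dl e with leaf-nbr (subst (Star l) dl (star l))
  ... | z , nb , _ with to (nb m) e
  ... | here refl = nb

  -- Next to a vertex of degree ≥ 3 there are no leaves (a leaf's neighbour has
  -- degree 2), so all neighbours have degree ≥ 2; as their degrees average 2,
  -- they all have degree exactly 2.
  nbr-of-high-deg : ∀ {x y} → 3 ≤ d x → Adj G x y ≡ true → d y ≡ 2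
  nbr-of-high-deg {x} {y} 3≤dx e = All.lookup all-two (to (N-nbhd x y) e)
    where
    -- If a neighbour z of x were a leaf, x would have degree 2.
    no-leaf-nbr : ∀ {z} → z ∈ N x → 2 ≤ d z
    no-leaf-nbr {z} z∈N with d z in dz | no-isolated z
    ... | suc zero    | _ = ⊥-elim (<-irrefl refl (subst (3 ≤_) dx≡2 3≤dx))
      where
      dx≡2 : d x ≡ 2
      dx≡2 = leaf-nbr-deg dz (adj-sym (from (N-nbhd x z) z∈N))
    ... | suc (suc _) | _ = s≤s (s≤s z≤n)
    balance : sum (map d (N x)) ≡ length (N x) * 2
    balance = begin
      sum (map d (N x)) ≡⟨ twoDeg≡sum x ⟨
      twoDeg G x        ≡⟨ harmonic x ⟩
      2 * d x           ≡⟨ *-comm 2 (d x) ⟩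
      d x * 2           ≡⟨ cong (_* 2) (deg≡length x) ⟩
      length (N x) * 2  ∎
      where open ≡-Reasoning
    all-two : All (λ z → d z ≡ 2) (N x)
    all-two = sum-tight 2 d (N x) (All.tabulate no-leaf-nbr) balance

  record Arm (r m : Fin n) : Set where
    field
      leaf      : Fin n
      mid-nbhd  : Nbhd (Adj G) m (r ∷ leaf ∷ [])
      leaf-nbhd : Nbhd (Adj G) leaf (m ∷ [])
      mid-deg   : d m ≡ 2
      leaf-deg  : d leaf ≡ 1

  -- Every neighbour m of a vertex r of degree ≥ 3 starts an arm: d(m) = 2, and the
  -- other neighbour l of m has d(r) + d(l) = 4, forcing d(r) = 3 and d(l) = 1.
  arm : ∀ {r m} → 3 ≤ d r → Adj G r m ≡ true → d r ≡ 3 × Arm r m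
  arm {r} {m} 3≤dr e with other-nbr (subst (Star m) (nbr-of-high-deg 3≤dr e) (star m)) (adj-sym e)
  ... | l , m-nbhd , dr+dl≡4 with tight-sum 3≤dr (no-isolated l) dr+dl≡4
  ... | dr≡3 , dl≡1 = dr≡3 , record
    { leaf      = l
    ; mid-nbhd  = m-nbhd
    ; leaf-nbhd = only-nbr-of-leaf dl≡1 (adj-sym (from (m-nbhd l) (there (here refl))))
    ; mid-deg   = nbr-of-high-deg 3≤dr e
    ; leaf-deg  = dl≡1
    }

  leaf⇒deg-three : ∀ {x} → d x ≡ 1 → Σ[ w ∈ Fin n ] d w ≡ 3
  leaf⇒deg-three {x} dx with leaf-nbr (subst (Star x) dx (star x))
  ... | z , x-nbhd , dz
    with other-nbr (subst (Star z) dz (star z)) (adj-sym (from (x-nbhd z) (here refl)))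
  ... | w , _ , dx+dw≡4 = w , suc-injective (trans (cong (_+ d w) (sym dx)) dx+dw≡4)

  -- Either some vertex has degree ≥ 3, or G is 2-regular: with all degrees ≤ 2
  -- there can be no leaf, as a leaf sees a vertex of degree 3.
  high-deg-or-regular : (Σ[ x ∈ Fin n ] 3 ≤ d x) ⊎ Regular G 2
  high-deg-or-regular with any? (λ x → 3 ≤? d x)
  ... | yes high = inj₁ high
  ... | no none  = inj₂ deg-two
    where
    no-leaf : ∀ {x} → d x ≢ 1
    no-leaf dx with leaf⇒deg-three dx
    ... | w , dw = none (w , subst (3 ≤_) (sym dw) ≤-refl)
    deg-two : ∀ x → d x ≡ 2
    deg-two x with d x in dx | no-isolated x
    ... | suc zero          | _ = ⊥-elim (no-leaf dx)
    ... | suc (suc zero)    | _ = refl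
    ... | suc (suc (suc k)) | _ = ⊥-elim (none (x , subst (3 ≤_) (sym dx) (s≤s (s≤s (s≤s z≤n)))))

  distinct-by-deg : ∀ {k k′ xs ys} → k ≢ k′ →
    All (λ x → d x ≡ k) xs → All (λ y → d y ≡ k′) ys → All (λ x → All (x ≢_) ys) xs
  distinct-by-deg {k} {k′} k≢k′ dxs dys = All.map (λ dx≡k → All.map (apart dx≡k) dys) dxs
    where
    apart : ∀ {x y} → d x ≡ k → d y ≡ k′ → x ≢ y
    apart dx≡k dy≡k′ x≡y = k≢k′ (trans (sym dx≡k) (trans (cong d x≡y) dy≡k′))

  module T₂Copy (r : Fin n) (3≤dr : 3 ≤ d r) (a b c : Fin n)
    (r-nbhd : Nbhd (Adj G) r (a ∷ b ∷ c ∷ [])) (abc-unique : Unique (a ∷ b ∷ c ∷ [])) where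
    open Arm

    arm-at : ∀ {m} → m ∈ a ∷ b ∷ c ∷ [] → Arm r m
    arm-at m∈ = proj₂ (arm 3≤dr (from (r-nbhd _) m∈))

    A : Arm r a
    A = arm-at (here refl)
    B : Arm r b
    B = arm-at (there (here refl))
    C : Arm r c
    C = arm-at (there (there (here refl)))

    vertices : List (Fin n)
    vertices = r ∷ a ∷ b ∷ c ∷ leaf A ∷ leaf B ∷ leaf C ∷ []

    embed : Fin 7 → Fin n
    embed = lookup vertices

    embed-nbhd : ∀ p → Nbhd (Adj G) (embed p) (map embed (T₂-nbrs p))
    embed-nbhd 0F = r-nbhd
    embed-nbhd 1F = mid-nbhd A
    embed-nbhd 2F = mid-nbhd B
    embed-nbhd 3F = mid-nbhd C
    embed-nbhd 4F = leaf-nbhd A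
    embed-nbhd 5F = leaf-nbhd B
    embed-nbhd 6F = leaf-nbhd C

    -- The leaves are distinct because they hang from the distinct a, b, c.
    leaves-unique : Unique (a ∷ b ∷ c ∷ []) → Unique (leaf A ∷ leaf B ∷ leaf C ∷ [])
    leaves-unique ((a≢b ∷ a≢c ∷ []) ∷ (b≢c ∷ []) ∷ [] ∷ []) =
      (apart A B a≢b ∷ apart A C a≢c ∷ []) ∷ (apart B C b≢c ∷ []) ∷ [] ∷ []
      where
      apart : ∀ {m m′} (X : Arm r m) (Y : Arm r m′) → m ≢ m′ → leaf X ≢ leaf Y
      apart X Y = leaves-distinct (leaf-nbhd X) (leaf-nbhd Y)

    -- All seven vertices are distinct: the three layers have degrees 3, 2, 1.
    vertices-unique : Unique vertices
    vertices-unique = ++⁺ ([] ∷ []) lower-unique (root-apart ∷ [])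
      where
      r-deg : All (λ x → d x ≡ 3) (r ∷ [])
      r-deg = proj₁ (arm 3≤dr (from (r-nbhd a) (here refl))) ∷ []
      mids-deg : All (λ x → d x ≡ 2) (a ∷ b ∷ c ∷ [])
      mids-deg = mid-deg A ∷ mid-deg B ∷ mid-deg C ∷ []
      leaves-deg : All (λ x → d x ≡ 1) (leaf A ∷ leaf B ∷ leaf C ∷ [])
      leaves-deg = leaf-deg A ∷ leaf-deg B ∷ leaf-deg C ∷ []
      lower-unique : Unique (a ∷ b ∷ c ∷ leaf A ∷ leaf B ∷ leaf C ∷ [])
      lower-unique = ++⁺ abc-unique (leaves-unique abc-unique) (distinct-by-deg (λ ()) mids-deg leaves-deg)
      root-apart : All (r ≢_) (a ∷ b ∷ c ∷ leaf A ∷ leaf B ∷ leaf C ∷ [])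
      root-apart = All.++⁺ (All.head (distinct-by-deg (λ ()) r-deg mids-deg))
                           (All.head (distinct-by-deg (λ ()) r-deg leaves-deg))

    embed-injective : Injective _≡_ _≡_ embed
    embed-injective = lookup-injective vertices-unique

    iso : Connected G → IsoT₂ G
    iso conn =
      Embedding.iso {m = 6} G conn T₂Adj T₂-nbrs T₂-nbhd embed embed-injective embed-nbhd

  tree : Connected G → ∀ {r} → 3 ≤ d r → IsoT₂ G
  tree conn {r} 3≤dr = from-star (subst (Star r) r-deg (star r))
    where
    r-deg : d r ≡ 3
    r-deg = proj₁ (arm 3≤dr (proj₂ (some-nbr r)))
    from-star : Star r 3 → IsoT₂ G
    from-star (mkStar (a ∷ b ∷ c ∷ []) r-nbhd abc-unique refl _) =
      T₂Copy.iso r 3≤dr a b c r-nbhd abc-unique conn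

lemma4p5 : (n : ℕ) (G : Graph n) → NoIsolated G → Connected G →
    PseudoRegular G 2 → IsoT₂ G
lemma4p5 n G no-isolated conn (harmonic , i , j , dᵢ≢dⱼ) = conclude high-deg-or-regular
  where
  open TwoHarmonic G no-isolated harmonic
  conclude : (Σ[ r ∈ Fin n ] 3 ≤ d r) ⊎ Regular G 2 → IsoT₂ G
  conclude (inj₁ (r , 3≤dr)) = tree conn 3≤dr
  conclude (inj₂ regular)    = ⊥-elim (dᵢ≢dⱼ (trans (regular i) (sym (regular j))))
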